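{- Let $\vec S=\varprojlim(\vec S_p\mid p\in P)$ be the inverse limit of an inverse system of finite separation systems. If $C\subseteq\vec S$ is a non-empty chain, then $C$ has a supremum and an infimum in $\vec S$, and both lie in the closure of $C$ in $\vec S$.
   Context: A separation system is a poset with an order-reversing involution. An inverse system over a directed poset $P$ consists of finite separation systems $\vec S_p$ and homomorphisms $f_{qp}\colon\vec S_q\to\vec S_p$ ($p<q$), i.e.\ maps commuting with the involutions and with $\vec r\le\vec s\Rightarrow f_{qp}(\vec r)\le f_{qp}(\vec s)$, satisfying $f_{rp}=f_{qp}\circ f_{rq}$. $\vec S$ consists of families $(\vec s_p)$ with $f_{qp}(\vec s_q)=\vec s_p$; $(\vec r_p)\le(\vec s_p)$ iff $\vec r_p\le\vec s_p$ for all $p$; involution componentwise; topology: subspace of the product of the discrete spaces $\vec S_p$. -}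

module Defs where

open import Data.Nat using (ℕ)
open import Data.Fin using (Fin)
open import Data.Product using (Σ; ∃; _×_; _,_)
open import Data.Sum using (_⊎_)
open import Data.List using (List)
open import Data.List.Relation.Unary.All using (All)
open import Relation.Nullary using (¬_; Dec)
open import Relation.Binary.PropositionalEquality using (_≡_)
open import Relation.Binary.Structures using (IsPartialOrder)
open import Function.Bundles using (_↔_)

-- Law of excluded middle (for propositions in Set), used as a hypothesis
-- since the paper reasons classically.
ExcludedMiddle : Set₁
ExcludedMiddle = (A : Set) → Dec A

record SepSys : Set₁ where
  field
    Carrier        : Set
    _≤_            : Carrier → Carrier → Set
    isPartialOrder : IsPartialOrder _≡_ _≤_
    _*             : Carrier → Carrier
    involutive     : ∀ s → (s *) * ≡ s
    reversing      : ∀ {r s} → r ≤ s → (s *) ≤ (r *)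

Finite : SepSys → Set
Finite S = Σ ℕ λ n → SepSys.Carrier S ↔ Fin n

record IsHom (S T : SepSys) (f : SepSys.Carrier S → SepSys.Carrier T) : Set where
  open SepSys
  field
    comm-* : ∀ s → f ((_*) S s) ≡ (_*) T (f s)
    mono   : ∀ {r s} → _≤_ S r s → _≤_ T (f r) (f s)

record DirectedPoset : Set₁ where
  field
    Carrier        : Set
    _≤_            : Carrier → Carrier → Set
    isPartialOrder : IsPartialOrder _≡_ _≤_
    directed       : ∀ p q → ∃ λ r → (p ≤ r) × (q ≤ r)

  _<_ : Carrier → Carrier → Set
  p < q = (p ≤ q) × ¬ (p ≡ q)

record InverseSystem (P : DirectedPoset) : Set₁ where
  open DirectedPoset P using (_<_) renaming (Carrier to Idx)
  field
    S      : Idx → SepSys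
    finite : ∀ p → Finite (S p)
    f      : ∀ {p q} → p < q → SepSys.Carrier (S q) → SepSys.Carrier (S p)
    f-hom  : ∀ {p q} (h : p < q) → IsHom (S q) (S p) (f h)
    f-comp : ∀ {p q r} (hpq : p < q) (hqr : q < r) (hpr : p < r) →
             ∀ x → f hpr x ≡ f hpq (f hqr x)

module Limit {P : DirectedPoset} (I : InverseSystem P) where
  open DirectedPoset P using (_<_) renaming (Carrier to Idx)
  open InverseSystem I

  record Elem : Set where
    constructor mkElem
    field
      at     : (p : Idx) → SepSys.Carrier (S p)
      compat : ∀ {p q} (h : p < q) → f h (at q) ≡ at p
  open Elem public

  _≤L_ : Elem → Elem → Set
  x ≤L y = ∀ p → SepSys._≤_ (S p) (at x p) (at y p)

  IsChain : (Elem → Set) → Set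
  IsChain C = ∀ x y → C x → C y → (x ≤L y) ⊎ (y ≤L x)

  IsSupremum : (Elem → Set) → Elem → Set
  IsSupremum C s = (∀ c → C c → c ≤L s) × (∀ u → (∀ c → C c → c ≤L u) → s ≤L u)

  IsInfimum : (Elem → Set) → Elem → Set
  IsInfimum C s = (∀ c → C c → s ≤L c) × (∀ u → (∀ c → C c → u ≤L c) → u ≤L s)

  -- Closure in the subspace topology of the product of discrete spaces:
  -- every basic open neighbourhood (fixing finitely many coordinates) meets C.
  InClosure : (Elem → Set) → Elem → Set
  InClosure C x = ∀ (ps : List Idx) →
    ∃ λ c → C c × All (λ p → at c p ≡ at x p) ps

module Submission where

open import Defs
open import Data.Product using (Σ; ∃; _×_; _,_; proj₁; proj₂)
open import Data.Sum using (_⊎_; inj₁; inj₂; swap)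
open import Data.Fin using (Fin)
open import Data.Empty using (⊥-elim)
open import Data.List using (List; []; _∷_; map; allFin)
open import Data.List.Relation.Unary.All as All using (All; []; _∷_)
open import Data.List.Relation.Unary.Any using (here; there)
open import Data.List.Membership.Propositional using (_∈_)
open import Data.List.Membership.Propositional.Properties using (∈-map⁺; ∈-allFin)
open import Function using (flip)
open import Function.Bundles using (_↔_; Inverse)
open import Relation.Nullary using (Dec; yes; no)
open import Relation.Binary.PropositionalEquality using (_≡_; refl; sym; cong; subst; module ≡-Reasoning)
open import Relation.Binary.Structures using (IsPreorder; IsPartialOrder)
import Relation.Binary.Construct.Flip.EqAndOrd as Flip

-- In each finite coordinate S_p the projection of the chain C is a
-- finite chain, so it has a greatest element m_p, attained by some c ∈ C.  If
-- c ∈ C attains m_q and p ≤ q, then c also attains m_p: any d ∈ C above c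
-- agrees with c at q by maximality, hence at p by compatibility.  This makes
-- (m_p) a compatible family, clearly the supremum of C, and given finitely many
-- indices, a chain element attaining the maximum at a common upper bound of
-- them agrees with (m_p) at all of them.  Infima are suprema for the reversed
-- order, which again has finite coordinates.

module _ {A : Set} {n} (e : A ↔ Fin n) where
  open Inverse e

  enumeration : List A
  enumeration = map from (allFin n)

  ∈-enumeration : ∀ y → y ∈ enumeration
  ∈-enumeration y = subst (_∈ enumeration) (strictlyInverseʳ y) (∈-map⁺ from (∈-allFin (to y)))

module _ {A : Set} {_≼_ : A → A → Set} (≼-isPreorder : IsPreorder _≡_ _≼_)
         {D : A → Set} (D? : ∀ a → Dec (D a))
         (D-total : ∀ a b → D a → D b → (a ≼ b) ⊎ (b ≼ a)) where
  open IsPreorder ≼-isPreorder using () renaming (refl to ≼-refl; trans to ≼-trans)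

  greatest-in-list : (L : List A) → ∀ {a} → D a →
                     Σ A λ m → D m × (∀ y → y ∈ L → D y → y ≼ m)
  greatest-in-list [] {a} Da = a , Da , λ _ ()
  greatest-in-list (y ∷ L) Da with greatest-in-list L Da
  ... | m , Dm , m-ub with D? y
  ... | no ¬Dy = m , Dm , λ { z (here refl) Dz → ⊥-elim (¬Dy Dz) ; z (there z∈L) Dz → m-ub z z∈L Dz }
  ... | yes Dy with D-total y m Dy Dm
  ... | inj₁ y≼m = m , Dm , λ { z (here refl) _ → y≼m ; z (there z∈L) Dz → m-ub z z∈L Dz }
  ... | inj₂ m≼y = y , Dy , λ { z (here refl) _ → ≼-refl ; z (there z∈L) Dz → ≼-trans (m-ub z z∈L Dz) m≼y }

  greatest-of-finite : ∀ {n} → A ↔ Fin n → ∀ {a} → D a →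
                       Σ A λ m → D m × (∀ y → D y → y ≼ m)
  greatest-of-finite e Da with greatest-in-list (enumeration e) Da
  ... | m , Dm , m-ub = m , Dm , λ y → m-ub y (∈-enumeration e y)

module _ (P : DirectedPoset) where
  open DirectedPoset P using (directed) renaming (Carrier to Idx; _≤_ to _⊑_)
  open IsPartialOrder (DirectedPoset.isPartialOrder P) using () renaming (refl to ⊑-refl; trans to ⊑-trans)

  upper-bound-of-list : ∀ p (ps : List Idx) → ∃ λ r → p ⊑ r × All (_⊑ r) ps
  upper-bound-of-list p [] = p , ⊑-refl , []
  upper-bound-of-list p (q ∷ ps) with upper-bound-of-list q ps
  ... | r , q⊑r , ps⊑r with directed p r
  ... | t , p⊑t , r⊑t = t , p⊑t , ⊑-trans q⊑r r⊑t ∷ All.map (λ p'⊑r → ⊑-trans p'⊑r r⊑t) ps⊑r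

-- The orders on the coordinates need not be related to the bonding maps, so
-- the same construction yields infima by reversing every coordinate order.
module ChainSupremum {P : DirectedPoset} (I : InverseSystem P) (lem : ExcludedMiddle)
    (R : ∀ p → SepSys.Carrier (InverseSystem.S I p) → SepSys.Carrier (InverseSystem.S I p) → Set)
    (R-isPartialOrder : ∀ p → IsPartialOrder _≡_ (R p))
    (C : Limit.Elem I → Set) {c₀ : Limit.Elem I} (c₀∈C : C c₀)
    (C-chain : ∀ c d → C c → C d →
               (∀ p → R p (Limit.at {I = I} c p) (Limit.at {I = I} d p)) ⊎
               (∀ p → R p (Limit.at {I = I} d p) (Limit.at {I = I} c p)))
    where
  open DirectedPoset P using (_<_) renaming (_≤_ to _⊑_)
  open IsPartialOrder (DirectedPoset.isPartialOrder P) using () renaming (refl to ⊑-refl)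
  open InverseSystem I
  open Limit I
  module R p = IsPartialOrder (R-isPartialOrder p)

  _≤ᴿ_ : Elem → Elem → Set
  x ≤ᴿ y = ∀ p → R p (at x p) (at y p)

  Coordinate : ∀ p → SepSys.Carrier (S p) → Set
  Coordinate p x = Σ Elem λ c → C c × at c p ≡ x

  coordinate-total : ∀ p x y → Coordinate p x → Coordinate p y → R p x y ⊎ R p y x
  coordinate-total p _ _ (c , c∈C , refl) (d , d∈C , refl) with C-chain c d c∈C d∈C
  ... | inj₁ c≤d = inj₁ (c≤d p)
  ... | inj₂ d≤c = inj₂ (d≤c p)

  greatest-coordinate : ∀ p → Σ (SepSys.Carrier (S p)) λ m → Coordinate p m × (∀ y → Coordinate p y → R p y m)
  greatest-coordinate p = greatest-of-finite (R.isPreorder p) (λ x → lem (Coordinate p x))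
                            (coordinate-total p) (proj₂ (finite p)) (c₀ , c₀∈C , refl)

  top : ∀ p → SepSys.Carrier (S p)
  top p = proj₁ (greatest-coordinate p)

  top-attained : ∀ p → Coordinate p (top p)
  top-attained p = proj₁ (proj₂ (greatest-coordinate p))

  below-top : ∀ {c} → C c → ∀ p → R p (at c p) (top p)
  below-top {c} c∈C p = proj₂ (proj₂ (greatest-coordinate p)) (at c p) (c , c∈C , refl)

  top-least : ∀ p {u} → (∀ {d} → C d → R p (at d p) u) → R p (top p) u
  top-least p {u} d≤u with top-attained p
  ... | d , d∈C , dp≡top = subst (λ z → R p z u) dp≡top (d≤u d∈C)

  attains-top-below : ∀ {p q} → p < q → ∀ {c} → C c → at c q ≡ top q → at c p ≡ top p
  attains-top-below {p} {q} p<q {c} c∈C cq≡top = R.antisym p (below-top c∈C p) (top-least p c-is-upper)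
    where
    c-is-upper : ∀ {d} → C d → R p (at d p) (at c p)
    c-is-upper {d} d∈C with C-chain d c d∈C c∈C
    ... | inj₁ d≤c = d≤c p
    ... | inj₂ c≤d = R.reflexive p (begin
      at d p          ≡⟨ sym (compat d p<q) ⟩
      f p<q (at d q)  ≡⟨ cong (f p<q) dq≡cq ⟩
      f p<q (at c q)  ≡⟨ compat c p<q ⟩
      at c p          ∎)
      where
      open ≡-Reasoning
      dq≡cq : at d q ≡ at c q
      dq≡cq = R.antisym q (subst (R q (at d q)) (sym cq≡top) (below-top d∈C q)) (c≤d q)

  attains-top-downward : ∀ {p q} → p ⊑ q → ∀ {c} → C c → at c q ≡ top q → at c p ≡ top p
  attains-top-downward {p} {q} p⊑q c∈C cq≡top with lem (p ≡ q)
  ... | yes refl = cq≡top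
  ... | no p≢q = attains-top-below (p⊑q , p≢q) c∈C cq≡top

  witness : ∀ p → Elem
  witness p = proj₁ (top-attained p)

  witness∈C : ∀ p → C (witness p)
  witness∈C p = proj₁ (proj₂ (top-attained p))

  witness-attains-top : ∀ {p q} → p ⊑ q → at (witness q) p ≡ top p
  witness-attains-top {q = q} p⊑q = attains-top-downward p⊑q (witness∈C q) (proj₂ (proj₂ (top-attained q)))

  sup : Elem
  sup = mkElem top (λ {p} {q} p<q → begin
    f p<q (top q)              ≡⟨ cong (f p<q) (sym (witness-attains-top ⊑-refl)) ⟩
    f p<q (at (witness q) q)   ≡⟨ compat (witness q) p<q ⟩
    at (witness q) p           ≡⟨ witness-attains-top (proj₁ p<q) ⟩
    top p                      ∎)
    where open ≡-Reasoning

  sup-upper : ∀ c → C c → c ≤ᴿ sup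
  sup-upper c c∈C = below-top c∈C

  sup-least : ∀ u → (∀ c → C c → c ≤ᴿ u) → sup ≤ᴿ u
  sup-least u C≤u p = top-least p (λ {d} d∈C → C≤u d d∈C p)

  sup-inClosure : InClosure C sup
  sup-inClosure [] = c₀ , c₀∈C , []
  sup-inClosure (p ∷ ps) with upper-bound-of-list P p ps
  ... | r , p⊑r , ps⊑r = witness r , witness∈C r , witness-attains-top p⊑r ∷ All.map witness-attains-top ps⊑r

lemma4p3 : ExcludedMiddle → (P : DirectedPoset) (I : InverseSystem P) →
    let open Limit I in
    (C : Elem → Set) → (∃ λ c → C c) → IsChain C →
    (∃ λ s → IsSupremum C s × InClosure C s) × (∃ λ i → IsInfimum C i × InClosure C i)
lemma4p3 lem P I C (c₀ , c₀∈C) C-chain =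
  (Sup.sup , (Sup.sup-upper , Sup.sup-least) , Sup.sup-inClosure) ,
  (Inf.sup , (Inf.sup-upper , Inf.sup-least) , Inf.sup-inClosure)
  where
  open InverseSystem I
  open Limit I
  ≤-isPartialOrder : ∀ p → IsPartialOrder _≡_ (SepSys._≤_ (S p))
  ≤-isPartialOrder p = SepSys.isPartialOrder (S p)
  module Sup = ChainSupremum I lem (λ p → SepSys._≤_ (S p)) ≤-isPartialOrder C c₀∈C C-chain
  module Inf = ChainSupremum I lem (λ p → flip (SepSys._≤_ (S p))) (λ p → Flip.isPartialOrder (≤-isPartialOrder p))
                 C c₀∈C (λ c d c∈C d∈C → swap (C-chain c d c∈C d∈C))
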